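{- Let $n\geq 1$ and let $K_n$ be the complete graph on $n$ vertices. Then $K_n$ is equitable list point $k$-arborable for every integer $k\geq \lceil n/2\rceil$, and moreover $\rho_l^=(K_n)=\lceil n/2\rceil$.
   Context: All graphs are finite, simple and undirected. A $k$-list assignment of a graph $G$ assigns to each vertex $v$ a set (list) $L(v)$ of $k$ colors. A graph $G$ is list point $k$-arborable if for every $k$-list assignment $L$ one can choose a color $c(v)\in L(v)$ for each vertex $v$ such that each color class induces an acyclic subgraph (a forest) of $G$. A graph $G$ is equitable list point $k$-arborable if for every $k$-list assignment $L$ one can choose $c(v)\in L(v)$ for each vertex $v$ such that each color class induces an acyclic subgraph of $G$ and each color appears on at most $\lceil |V(G)|/k\rceil$ vertices of $G$. The equitable list point arboricity $\rho_l^=(G)$ is the minimum integer $k$ such that $G$ is equitable list point $k$-arborable. -}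

module Defs where

open import Level using (0ℓ)
open import Data.Nat using (ℕ; zero; suc; _+_; _≤_; _<_; _/_)
open import Data.Nat.Properties using (_≟_)
open import Data.Fin using (Fin; zero; suc; inject₁; fromℕ)
open import Data.List using (List; length; filter; allFin)
open import Data.List.Membership.Propositional using (_∈_)
open import Data.List.Relation.Unary.Unique.Propositional using (Unique)
open import Data.Product using (Σ; _×_)
open import Function.Definitions using (Injective)
open import Relation.Binary.PropositionalEquality using (_≡_; _≢_)
open import Relation.Nullary using (¬_)

record Graph (n : ℕ) : Set₁ where
  field
    Adj   : Fin n → Fin n → Set
    sym   : ∀ {u v} → Adj u v → Adj v u
    irrefl : ∀ {v} → ¬ Adj v v
open Graph public

K : (n : ℕ) → Graph n
K n = record { Adj = λ u v → u ≢ v ; sym = λ u≢v v≡u → u≢v (Relation.Binary.PropositionalEquality.sym v≡u) ; irrefl = λ v≢v → v≢v Relation.Binary.PropositionalEquality.refl }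

-- A cycle of G of length m+3: distinct vertices f 0, ..., f (m+2) with
-- f i adjacent to f (i+1) and f (m+2) adjacent to f 0.
record Cycle {n : ℕ} (G : Graph n) : Set where
  field
    m      : ℕ
    vert   : Fin (suc (suc (suc m))) → Fin n
    inj    : Injective _≡_ _≡_ vert
    step   : (i : Fin (suc (suc m))) → Adj G (vert (inject₁ i)) (vert (suc i))
    close  : Adj G (vert (fromℕ (suc (suc m)))) (vert zero)
open Cycle public

-- Colors are natural numbers. A coloring c is acyclic when no cycle of G
-- is monochromatic, i.e. every color class induces a forest.
Acyclic : {n : ℕ} → Graph n → (Fin n → ℕ) → Set
Acyclic G c = (C : Cycle G) → ¬ (∀ i → c (vert C i) ≡ c (vert C zero))

ListAssignment : (n k : ℕ) → Set
ListAssignment n k = Σ (Fin n → List ℕ) λ L → ∀ v → Unique (L v) × length (L v) ≡ k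

-- ⌈ a / b ⌉ (for b ≥ 1; set to 0 for b = 0, where it is never relevant
-- since 0-lists admit no coloring when n ≥ 1).
ceilDiv : ℕ → ℕ → ℕ
ceilDiv a zero = 0
ceilDiv a (suc b) = (a + b) / suc b

colorCount : {n : ℕ} → (Fin n → ℕ) → ℕ → ℕ
colorCount {n} c col = length (filter (λ v → c v ≟ col) (allFin n))

EqListPointArborable : {n : ℕ} → Graph n → ℕ → Set
EqListPointArborable {n} G k =
  (L : ListAssignment n k) →
  Σ (Fin n → ℕ) λ c →
    (∀ v → c v ∈ Data.Product.proj₁ L v) ×
    Acyclic G c ×
    (∀ col → colorCount c col ≤ ceilDiv n k)

EqListPointArboricityIs : {n : ℕ} → Graph n → ℕ → Set
EqListPointArboricityIs G r =
  EqListPointArborable G r × (∀ k → k < r → ¬ EqListPointArborable G k)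

-- In K_n every three vertices span a triangle, so a colouring is acyclic exactly when
-- every colour class has at most two vertices. Hence with lists of size k ≥ ⌈n/2⌉ it
-- suffices to colour greedily with capacity ⌈n/k⌉ ≤ 2: when a vertex is reached, its k
-- colours cannot all be full, as that would need at least k⌈n/k⌉ ≥ n earlier vertices.
-- Conversely, if k < ⌈n/2⌉ then n > 2k, and giving every vertex the list {0, …, k-1}
-- forces some colour onto three vertices, i.e. onto a monochromatic triangle.
module Submission where

open import Defs
open import Data.Nat using (ℕ; _≤_; ⌈_/2⌉)
open import Data.Product using (_×_)
open import Data.Nat using (zero; suc; _+_; _*_; _<_; z≤n; s≤s; s≤s⁻¹; _≤?_; _<?_; ⌊_/2⌋; _%_)
open import Data.Nat.Properties
open import Data.Nat.DivMod using (m≡m%n+[m/n]*n; m%n<n; m<n*o⇒m/o<n)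
open import Data.Fin using (Fin; zero; suc; toℕ; inject≤)
open import Data.Fin.Properties using (injective⇒≤; inject≤-injective; toℕ-inject₁)
open import Data.List using (List; []; _∷_; length; filter; allFin; tabulate; upTo; lookup; map)
open import Data.Nat.ListAction using (sum)
open import Data.List.Properties using (length-upTo; length-tabulate; filter-none; filter-accept; filter-reject)
open import Data.List.Membership.Propositional using (_∈_; find)
open import Data.List.Membership.Propositional.Properties using (∈-filter⁺; ∈-filter⁻; ∈-allFin; ∈-lookup)
open import Data.List.Relation.Unary.Any as Any using (any?)
open import Data.List.Relation.Unary.Any.Properties using (lookup-index)
open import Data.List.Relation.Unary.All as All using (All; []; _∷_)
open import Data.List.Relation.Unary.All.Properties using (¬Any⇒All¬; tabulate⁺)
open import Data.List.Relation.Unary.AllPairs using ([]; _∷_)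
open import Data.List.Relation.Unary.Unique.Propositional using (Unique)
open import Data.List.Relation.Unary.Unique.Propositional.Properties using (upTo⁺; allFin⁺; filter⁺)
open import Data.Vec.Functional as Vector using ()
open import Data.Product using (Σ; _,_; proj₁; proj₂)
open import Data.Empty using (⊥-elim)
open import Relation.Nullary using (¬_; yes; no)
open import Relation.Binary.PropositionalEquality as ≡ using (_≡_; refl; trans; cong; subst; module ≡-Reasoning)
open import Function using (_∘_; _⇔_; mk⇔; Equivalence)
open import Function.Definitions using (Injective)
open import Algebra.Properties.CommutativeSemigroup +-commutativeSemigroup using (x∙yz≈y∙xz)

multiplicity : ℕ → List ℕ → ℕ
multiplicity x ys = length (filter (_≟ x) ys)

sum-map-≤ : ∀ {b} (f : ℕ → ℕ) → (∀ x → f x ≤ b) → ∀ xs → sum (map f xs) ≤ length xs * b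
sum-map-≤ f f≤b []       = z≤n
sum-map-≤ f f≤b (x ∷ xs) = +-mono-≤ (f≤b x) (sum-map-≤ f f≤b xs)

sum-map-≥ : ∀ {b} (f : ℕ → ℕ) {xs} → All (λ x → b ≤ f x) xs → length xs * b ≤ sum (map f xs)
sum-map-≥ f []           = z≤n
sum-map-≥ f (b≤fx ∷ b≤f) = +-mono-≤ b≤fx (sum-map-≥ f b≤f)

+-shift : ∀ m p {s t} → s ≡ p + t → m + s ≡ p + (m + t)
+-shift m p {t = t} refl = x∙yz≈y∙xz m p t

sum-multiplicity-∷ : ∀ y ys xs →
  sum (map (λ x → multiplicity x (y ∷ ys)) xs) ≡
  multiplicity y xs + sum (map (λ x → multiplicity x ys) xs)
sum-multiplicity-∷ y ys []       = refl
sum-multiplicity-∷ y ys (x ∷ xs) with y ≟ x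
... | yes refl
  rewrite filter-accept (_≟ y) {y} {ys} refl | filter-accept (_≟ y) {y} {xs} refl
  = cong suc (+-shift (multiplicity y ys) (multiplicity y xs) (sum-multiplicity-∷ y ys xs))
... | no y≢x
  rewrite filter-reject (_≟ x) {y} {ys} y≢x | filter-reject (_≟ y) {x} {xs} (y≢x ∘ ≡.sym)
  = +-shift (multiplicity x ys) (multiplicity y xs) (sum-multiplicity-∷ y ys xs)

multiplicity≤1 : ∀ {y xs} → Unique xs → multiplicity y xs ≤ 1
multiplicity≤1 {y} {[]}     []           = z≤n
multiplicity≤1 {y} {x ∷ xs} (x∉xs ∷ uxs) with y ≟ x
... | yes refl rewrite filter-accept (_≟ y) {y} {xs} refl
                     | filter-none (_≟ y) (All.map (_∘ ≡.sym) x∉xs) = s≤s z≤n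
... | no y≢x   rewrite filter-reject (_≟ y) {x} {xs} (y≢x ∘ ≡.sym) = multiplicity≤1 uxs

∈⇒1≤multiplicity : ∀ {y xs} → y ∈ xs → 1 ≤ multiplicity y xs
∈⇒1≤multiplicity {y} {xs} y∈xs with filter (_≟ y) xs | ∈-filter⁺ (_≟ y) y∈xs refl
... | _ ∷ _ | _ = s≤s z≤n

sum-multiplicity≤length : ∀ {xs} → Unique xs → ∀ ys →
  sum (map (λ x → multiplicity x ys) xs) ≤ length ys
sum-multiplicity≤length {xs} uxs [] =
  ≤-trans (sum-map-≤ (λ x → multiplicity x []) (λ _ → z≤n) xs) (≤-reflexive (*-zeroʳ (length xs)))
sum-multiplicity≤length {xs} uxs (y ∷ ys) = begin
  sum (map (λ x → multiplicity x (y ∷ ys)) xs)               ≡⟨ sum-multiplicity-∷ y ys xs ⟩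
  multiplicity y xs + sum (map (λ x → multiplicity x ys) xs) ≤⟨ +-mono-≤ (multiplicity≤1 uxs)
                                                                          (sum-multiplicity≤length uxs ys) ⟩
  suc (length ys)                                            ∎
  where open ≤-Reasoning

length≤sum-multiplicity : ∀ {xs ys} → All (_∈ xs) ys →
  length ys ≤ sum (map (λ x → multiplicity x ys) xs)
length≤sum-multiplicity {xs} {[]}     []             = z≤n
length≤sum-multiplicity {xs} {y ∷ ys} (y∈xs ∷ ys⊆xs) = begin
  suc (length ys)                                            ≤⟨ +-mono-≤ (∈⇒1≤multiplicity y∈xs)
                                                                          (length≤sum-multiplicity ys⊆xs) ⟩
  multiplicity y xs + sum (map (λ x → multiplicity x ys) xs) ≡⟨ sum-multiplicity-∷ y ys xs ⟨
  sum (map (λ x → multiplicity x (y ∷ ys)) xs)               ∎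
  where open ≤-Reasoning

free-colour : ∀ {b xs} ys → Unique xs → length ys < length xs * b →
  Σ ℕ λ x → x ∈ xs × multiplicity x ys < b
free-colour {b} {xs} ys uxs short with any? (λ x → multiplicity x ys <? b) xs
... | yes room = find room
... | no full  = ⊥-elim (<⇒≱ short (begin
  length xs * b                                 ≤⟨ sum-map-≥ (λ x → multiplicity x ys)
                                                     (All.map ≮⇒≥ (¬Any⇒All¬ xs full)) ⟩
  sum (map (λ x → multiplicity x ys) xs)        ≤⟨ sum-multiplicity≤length uxs ys ⟩
  length ys                                     ∎))
  where open ≤-Reasoning

capacitated-colouring : ∀ {m k} b (L : ListAssignment m k) → m ≤ k * b →
  Σ (Fin m → ℕ) λ c → (∀ v → c v ∈ proj₁ L v) × (∀ col → multiplicity col (tabulate c) ≤ b)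
capacitated-colouring {zero}  b L m≤kb = (λ ()) , (λ ()) , λ _ → z≤n
capacitated-colouring {suc m} b (L , ok) m≤kb
  with capacitated-colouring b (L ∘ suc , ok ∘ suc) (≤-trans (n≤1+n m) m≤kb)
... | c , c∈L , c-fits
  with free-colour (tabulate c) (proj₁ (ok zero)) m<kb
  where
  m<kb : length (tabulate c) < length (L zero) * b
  m<kb rewrite length-tabulate c | proj₂ (ok zero) = m≤kb
... | x , x∈L , x-free = x Vector.∷ c , extended∈L , fits
  where
  extended∈L : ∀ v → (x Vector.∷ c) v ∈ L v
  extended∈L zero    = x∈L
  extended∈L (suc v) = c∈L v
  fits : ∀ col → multiplicity col (x ∷ tabulate c) ≤ b
  fits col with x ≟ col
  ... | yes refl rewrite filter-accept (_≟ x) {x} {tabulate c} refl = x-free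
  ... | no x≢col rewrite filter-reject (_≟ col) {x} {tabulate c} x≢col = c-fits col

colorCount≡multiplicity : ∀ {n} (c : Fin n → ℕ) col → colorCount c col ≡ multiplicity col (tabulate c)
colorCount≡multiplicity {n} c col = along n (λ v → v)
  where
  along : ∀ m (f : Fin m → Fin n) →
    length (filter (λ v → c v ≟ col) (tabulate f)) ≡ multiplicity col (tabulate (c ∘ f))
  along zero    f = refl
  along (suc m) f with c (f zero) ≟ col
  ... | yes hit rewrite filter-accept (λ v → c v ≟ col) {f zero} {tabulate (f ∘ suc)} hit
                      | filter-accept (_≟ col) {c (f zero)} {tabulate (c ∘ f ∘ suc)} hit
                      = cong suc (along m (f ∘ suc))
  ... | no miss rewrite filter-reject (λ v → c v ≟ col) {f zero} {tabulate (f ∘ suc)} miss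
                      | filter-reject (_≟ col) {c (f zero)} {tabulate (c ∘ f ∘ suc)} miss
                      = along m (f ∘ suc)

injection-cycle : ∀ {n m} (f : Fin (3 + m) → Fin n) → Injective _≡_ _≡_ f → Cycle (K n)
injection-cycle {m = m} f f-inj = record
  { m     = m
  ; vert  = f
  ; inj   = f-inj
  ; step  = λ i e → 1+n≢n (≡.sym (trans (≡.sym (toℕ-inject₁ i)) (cong toℕ (f-inj e))))
  ; close = λ e → 0≢1+n (cong toℕ (≡.sym (f-inj e)))
  }

injective-members⇒≤length : ∀ {A : Set} {m} {f : Fin m → A} {xs : List A} →
  Injective _≡_ _≡_ f → (∀ i → f i ∈ xs) → m ≤ length xs
injective-members⇒≤length {f = f} {xs} f-inj f∈xs = injective⇒≤ index-inj
  where
  index-inj : Injective _≡_ _≡_ (λ i → Any.index (f∈xs i))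
  index-inj {i} {j} e = f-inj (begin
    f i                            ≡⟨ lookup-index (f∈xs i) ⟩
    lookup xs (Any.index (f∈xs i)) ≡⟨ cong (lookup xs) e ⟩
    lookup xs (Any.index (f∈xs j)) ≡⟨ lookup-index (f∈xs j) ⟨
    f j                            ∎)
    where open ≡-Reasoning

lookup-injective : ∀ {A : Set} {xs : List A} → Unique xs → Injective _≡_ _≡_ (lookup xs)
lookup-injective {xs = _ ∷ _} _             {zero}  {zero}  _ = refl
lookup-injective {xs = _ ∷ _} (x∉xs ∷ _)    {zero}  {suc j} e = ⊥-elim (All.lookup x∉xs (∈-lookup j) e)
lookup-injective {xs = _ ∷ _} (x∉xs ∷ _)    {suc i} {zero}  e = ⊥-elim (All.lookup x∉xs (∈-lookup i) (≡.sym e))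
lookup-injective {xs = _ ∷ _} (_ ∷ uxs)     {suc i} {suc j} e = cong suc (lookup-injective uxs e)

colorClass : ∀ {n} → (Fin n → ℕ) → ℕ → List (Fin n)
colorClass {n} c col = filter (λ v → c v ≟ col) (allFin n)

acyclic⇔classes≤2 : ∀ {n} (c : Fin n → ℕ) → Acyclic (K n) c ⇔ (∀ col → colorCount c col ≤ 2)
acyclic⇔classes≤2 {n} c = mk⇔ acyclic⇒classes≤2 classes≤2⇒acyclic
  where
  classes≤2⇒acyclic : (∀ col → colorCount c col ≤ 2) → Acyclic (K n) c
  classes≤2⇒acyclic small C mono = <⇒≱ (s≤s (small _)) (≤-trans (m≤m+n 3 (m C))
    (injective-members⇒≤length (inj C) λ i → ∈-filter⁺ (λ v → c v ≟ _) (∈-allFin _) (mono i)))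

  acyclic⇒classes≤2 : Acyclic (K n) c → ∀ col → colorCount c col ≤ 2
  acyclic⇒classes≤2 acyclic col with colorCount c col ≤? 2
  ... | yes small = small
  ... | no big    = ⊥-elim (acyclic triangle monochromatic)
    where
    corner : Fin 3 → Fin n
    corner = lookup (colorClass c col) ∘ (λ i → inject≤ i (≰⇒> big))
    triangle : Cycle (K n)
    triangle = injection-cycle corner λ e → inject≤-injective _ _ _ _
      (lookup-injective (filter⁺ (λ v → c v ≟ col) (allFin⁺ n)) e)
    colour : ∀ i → c (corner i) ≡ col
    colour i = proj₂ (∈-filter⁻ (λ v → c v ≟ col) {xs = allFin n} (∈-lookup _))
    monochromatic : ∀ i → c (corner i) ≡ c (corner zero)
    monochromatic i = trans (colour i) (≡.sym (colour zero))

⌈n/2⌉≤k⇔n≤2*k : ∀ {n k} → ⌈ n /2⌉ ≤ k ⇔ n ≤ 2 * k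
⌈n/2⌉≤k⇔n≤2*k {n} {k} = mk⇔ to from
  where
  open ≤-Reasoning
  to : ⌈ n /2⌉ ≤ k → n ≤ 2 * k
  to h = begin
    n                       ≡⟨ ⌊n/2⌋+⌈n/2⌉≡n n ⟨
    ⌊ n /2⌋ + ⌈ n /2⌉       ≤⟨ +-mono-≤ (≤-trans (⌊n/2⌋≤⌈n/2⌉ n) h) h ⟩
    k + k                   ≡⟨ cong (k +_) (+-identityʳ k) ⟨
    2 * k                   ∎
  from : n ≤ 2 * k → ⌈ n /2⌉ ≤ k
  from h = begin
    ⌈ n /2⌉                 ≤⟨ ⌈n/2⌉-mono (≤-trans h (≤-reflexive (cong (k +_) (+-identityʳ k)))) ⟩
    ⌈ k + k /2⌉             ≡⟨ n≡⌈n+n/2⌉ k ⟨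
    k                       ∎

≤*ceilDiv : ∀ n k → n ≤ suc k * ceilDiv n (suc k)
≤*ceilDiv n k = +-cancelʳ-≤ k n (suc k * q) (begin
  n + k                        ≡⟨ m≡m%n+[m/n]*n (n + k) (suc k) ⟩
  (n + k) % suc k + q * suc k  ≤⟨ +-monoˡ-≤ (q * suc k) (s≤s⁻¹ (m%n<n (n + k) (suc k))) ⟩
  k + q * suc k                ≡⟨ +-comm k (q * suc k) ⟩
  q * suc k + k                ≡⟨ cong (_+ k) (*-comm q (suc k)) ⟩
  suc k * q + k                ∎)
  where
  open ≤-Reasoning
  q = ceilDiv n (suc k)

ceilDiv≤ : ∀ {n k q} → n ≤ q * suc k → ceilDiv n (suc k) ≤ q
ceilDiv≤ {n} {k} {q} h = s≤s⁻¹ (m<n*o⇒m/o<n (begin-strict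
  n + k               ≤⟨ +-monoˡ-≤ k h ⟩
  q * suc k + k       <⟨ n<1+n _ ⟩
  suc (q * suc k + k) ≡⟨ cong suc (+-comm (q * suc k) k) ⟩
  suc q * suc k       ∎))
  where open ≤-Reasoning

≤2*⇒K-arborable : ∀ {n k} → n ≤ 2 * suc k → EqListPointArborable (K n) (suc k)
≤2*⇒K-arborable {n} {k} n≤2k L = c , c∈L , Equivalence.from (acyclic⇔classes≤2 c) classes≤2 , classes≤b
  where
  b = ceilDiv n (suc k)
  colouring = capacitated-colouring b L (≤*ceilDiv n k)
  c = proj₁ colouring
  c∈L = proj₁ (proj₂ colouring)
  classes≤b : ∀ col → colorCount c col ≤ b
  classes≤b col = subst (_≤ b) (≡.sym (colorCount≡multiplicity c col)) (proj₂ (proj₂ colouring) col)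
  classes≤2 : ∀ col → colorCount c col ≤ 2
  classes≤2 col = ≤-trans (classes≤b col) (ceilDiv≤ n≤2k)

K-arborable⇒≤2* : ∀ {n k} → EqListPointArborable (K n) k → n ≤ 2 * k
K-arborable⇒≤2* {n} {k} arborable = begin
  n                                                      ≡⟨ length-tabulate c ⟨
  length (tabulate c)                                    ≤⟨ length≤sum-multiplicity (tabulate⁺ c∈upTo) ⟩
  sum (map (λ x → multiplicity x (tabulate c)) (upTo k)) ≤⟨ sum-map-≤ _ classes≤2 (upTo k) ⟩
  length (upTo k) * 2                                    ≡⟨ cong (_* 2) (length-upTo k) ⟩
  k * 2                                                  ≡⟨ *-comm k 2 ⟩
  2 * k                                                  ∎
  where
  open ≤-Reasoning
  colouring = arborable ((λ _ → upTo k) , λ _ → upTo⁺ k , length-upTo k)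
  c = proj₁ colouring
  c∈upTo = proj₁ (proj₂ colouring)
  classes≤2 : ∀ col → multiplicity col (tabulate c) ≤ 2
  classes≤2 col = subst (_≤ 2) (colorCount≡multiplicity c col)
    (Equivalence.to (acyclic⇔classes≤2 c) (proj₁ (proj₂ (proj₂ colouring))) col)

theorem1 : (n : ℕ) → 1 ≤ n →
    ((k : ℕ) → ⌈ n /2⌉ ≤ k → EqListPointArborable (K n) k) ×
    EqListPointArboricityIs (K n) ⌈ n /2⌉
theorem1 (suc n) _ = upper , upper ⌈ suc n /2⌉ ≤-refl , lower
  where
  upper : (k : ℕ) → ⌈ suc n /2⌉ ≤ k → EqListPointArborable (K (suc n)) k
  upper (suc k) h = ≤2*⇒K-arborable (Equivalence.to ⌈n/2⌉≤k⇔n≤2*k h)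
  lower : ∀ k → k < ⌈ suc n /2⌉ → ¬ EqListPointArborable (K (suc n)) k
  lower k k<⌈n/2⌉ arborable = <⇒≱ k<⌈n/2⌉ (Equivalence.from ⌈n/2⌉≤k⇔n≤2*k (K-arborable⇒≤2* arborable))
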